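{- Let $n\ge 1$ and consider the $n$-vertex Fibonacci graph $FG$ (vertices $1,\dots,n$; edges $(v,v+1)$ labelled $a_v$ for $1\le v\le n-1$ and $(v,v+2)$ labelled $b_v$ for $1\le v\le n-2$). Let $T(n)$ and $P(n)$ be the total number of terms and the number of plus operators in the expression of $FG$ produced by the optimal reduction method. Then: 1. $T(1)=0$, $T(2)=1$, $T(3)=3$, $T(4)=6$, $T(5)=9$, and $T(n)=T(n-2)+T(n-4)+7$ for $n>5$. 2. $P(1)=0$, $P(2)=0$, $P(3)=1$, $P(4)=2$, $P(5)=3$, and $P(n)=P(n-2)+P(n-4)+3$ for $n>5$.
   Context: Reduction processes (for $n\ge 3$). Edges carry labels; initially edge $(v,v+1)$ has label $a_v$ and $(v,v+2)$ has label $b_v$. At every stage the current labelled graph has vertices $u_1<\dots<u_k$ (with $u_1=1$, $u_k=n$) and edges $(u_r,u_{r+1})$, $(u_r,u_{r+2})$. While $k>3$, one step is performed: (Fork step) with labels $A,B,C,D$ on $(u_1,u_2),(u_2,u_3),(u_2,u_4),(u_1,u_3)$: delete $u_2$ and its incident edges, add $(u_1,u_4)$ labelled $AC$, and replace $(u_1,u_3)$ by an edge labelled $D+AB$. (Joint step) with labels $A,B,C,D$ on $(u_{k-1},u_k),(u_{k-2},u_{k-1}),(u_{k-3},u_{k-1}),(u_{k-2},u_k)$: delete $u_{k-1}$ and its incident edges, add $(u_{k-3},u_k)$ labelled $CA$, and replace $(u_{k-2},u_k)$ by an edge labelled $D+BA$. When $k=3$, with labels $A,B,D$ on $(u_1,u_2),(u_2,u_3),(u_1,u_3)$,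 the final expression is $D+AB$. For $n\le 2$ the graph is a single vertex (expression $1$, containing no terms) or a single edge (expression $a_1$). The optimal reduction method uses any process whose number $f$ of fork steps and number $j$ of joint steps satisfy $f=j$ for odd $n$ and $|f-j|=1$ for even $n$ (the term and plus counts of the result depend only on $n$). Sums are parenthesized when multiplied. The total number of terms of an expression is the number of occurrences of the labels $a_v,b_v$ in it, counted with multiplicity; the number of plus operators is the number of occurrences of $+$. -}

module Defs where

open import Data.Nat using (ℕ; zero; suc; _+_; _%_)
open import Data.Fin using (toℕ)
open import Data.Vec using (Vec; []; _∷_; _∷ʳ_; init; last; tabulate)
open import Data.Product using (_×_)
open import Data.Sum using (_⊎_)
open import Relation.Binary.PropositionalEquality using (_≡_)

data Expr : Set where
  one  : Expr
  a    : ℕ → Expr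
  b    : ℕ → Expr
  _⊕_  : Expr → Expr → Expr
  _⊗_  : Expr → Expr → Expr

terms : Expr → ℕ
terms one = 0
terms (a _) = 1
terms (b _) = 1
terms (e ⊕ f) = terms e + terms f
terms (e ⊗ f) = terms e + terms f

pluses : Expr → ℕ
pluses one = 0
pluses (a _) = 0
pluses (b _) = 0
pluses (e ⊕ f) = suc (pluses e + pluses f)
pluses (e ⊗ f) = pluses e + pluses f

-- Labelled graph on vertices u_1 < ... < u_k with k = m + 3:
--   short r = label of (u_r , u_{r+1}),  r = 1 .. k-1
--   long  r = label of (u_r , u_{r+2}),  r = 1 .. k-2
record State (m : ℕ) : Set where
  constructor st
  field
    short : Vec Expr (suc (suc m))
    long  : Vec Expr (suc m)

-- Fork step: A = (u1,u2), B = (u2,u3), C = (u2,u4), D = (u1,u3)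
fork : ∀ {m} → State (suc m) → State m
fork (st (A ∷ B ∷ ss) (D ∷ C ∷ ls)) = st ((D ⊕ (A ⊗ B)) ∷ ss) ((A ⊗ C) ∷ ls)

-- Joint step: A = (u_{k-1},u_k), B = (u_{k-2},u_{k-1}),
--             C = (u_{k-3},u_{k-1}), D = (u_{k-2},u_k)
joint : ∀ {m} → State (suc m) → State m
joint (st s l) =
  let A = last s
      B = last (init s)
      D = last l
      C = last (init l)
  in st (init (init s) ∷ʳ (D ⊕ (B ⊗ A))) (init (init l) ∷ʳ (C ⊗ A))

data Step : Set where
  Fork Joint : Step

run : ∀ {m} → Vec Step m → State m → Expr
run [] (st (A ∷ B ∷ []) (D ∷ [])) = D ⊕ (A ⊗ B)
run (Fork ∷ ps) σ = run ps (fork σ)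
run (Joint ∷ ps) σ = run ps (joint σ)

fibGraph : (m : ℕ) → State m
fibGraph m = st (tabulate (λ i → a (suc (toℕ i)))) (tabulate (λ i → b (suc (toℕ i))))

countForks : ∀ {m} → Vec Step m → ℕ
countForks [] = 0
countForks (Fork ∷ ps) = suc (countForks ps)
countForks (Joint ∷ ps) = countForks ps

countJoints : ∀ {m} → Vec Step m → ℕ
countJoints [] = 0
countJoints (Fork ∷ ps) = countJoints ps
countJoints (Joint ∷ ps) = suc (countJoints ps)

Balanced : ℕ → ℕ → ℕ → Set
Balanced n f j = (n % 2 ≡ 1 → f ≡ j) × (n % 2 ≡ 0 → (f ≡ suc j ⊎ j ≡ suc f))

data OptimalExpr : ℕ → Expr → Set where
  opt1 : OptimalExpr 1 one
  opt2 : OptimalExpr 2 (a 1)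
  optRun : ∀ m (ps : Vec Step m) →
           Balanced (m + 3) (countForks ps) (countJoints ps) →
           OptimalExpr (m + 3) (run ps (fibGraph m))

T : ℕ → ℕ
T 0 = 0
T 1 = 0
T 2 = 1
T 3 = 3
T 4 = 6
T 5 = 9
T (suc (suc (suc (suc (suc (suc n)))))) = T (suc (suc (suc (suc n)))) + T (suc (suc n)) + 7

P : ℕ → ℕ
P 0 = 0
P 1 = 0
P 2 = 0
P 3 = 1
P 4 = 2
P 5 = 3
P (suc (suc (suc (suc (suc (suc n)))))) = P (suc (suc (suc (suc n)))) + P (suc (suc n)) + 3

module Submission where

-- Counting labels and pluses is a homomorphism to ℕ (each label weighs w, each plus c), so the
-- reduction can be run on edge weights alone. Forks act only at the left end of the graph and joints
-- only at the right end, so after f forks and j joints all edges still weigh w except the two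
-- outermost ones at each end, whose weights depend on f resp. j alone. Hence the final weight, shifted
-- by 7w + 3c, is U (f + 1) + U (j + 1) for a Fibonacci-like U. Restricted to indices of one parity,
-- T + 7 and P + 3 are Fibonacci-like too, and balanced pairs (f , j) match the two parities.

open import Defs
open import Data.Nat using (ℕ; _≤_; zero; suc; _+_; _*_; _%_; s≤s)
open import Data.Nat.Properties using (+-comm; +-suc; +-identityʳ; +-cancelʳ-≡)
open import Data.Nat.DivMod using (m%n<n)
open import Data.Nat.Tactic.RingSolver using (solve-∀)
open import Data.Fin using (Fin; toℕ)
open import Data.Product using (_×_; _,_; proj₁)
open import Data.Sum using (_⊎_; inj₁; inj₂)
open import Data.Vec using (Vec; []; _∷_; _∷ʳ_; init; last; map; replicate; tabulate; allFin)
open import Data.Vec.Properties using (init-∷ʳ; last-∷ʳ; map-∷ʳ; tabulate-∘; tabulate-cong; tabulate-allFin; map-const)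
open import Function using (_∘_; const)
open import Relation.Binary.PropositionalEquality using (_≡_; refl; cong; cong₂; trans; module ≡-Reasoning)
open ≡-Reasoning

map-init : ∀ {A B : Set} {n} (f : A → B) (xs : Vec A (suc n)) → map f (init xs) ≡ init (map f xs)
map-init {n = zero} f (x ∷ []) = refl
map-init {n = suc n} f (x ∷ xs) = cong (f x ∷_) (map-init f xs)

map-last : ∀ {A B : Set} {n} (f : A → B) (xs : Vec A (suc n)) → f (last xs) ≡ last (map f xs)
map-last {n = zero} f (x ∷ []) = refl
map-last {n = suc n} f (x ∷ xs) = map-last f xs

replicate-∷ʳ : ∀ {A : Set} n (x : A) → replicate (suc n) x ≡ replicate n x ∷ʳ x
replicate-∷ʳ zero x = refl
replicate-∷ʳ (suc n) x = cong (x ∷_) (replicate-∷ʳ n x)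

record IsFibLike (u : ℕ → ℕ) : Set where
  constructor fibLike
  field
    step : ∀ q → u (2 + q) ≡ u (1 + q) + u q

open IsFibLike

fibLike-unique : ∀ {u v} → IsFibLike u → IsFibLike v → u 0 ≡ v 0 → u 1 ≡ v 1 → ∀ q → u q ≡ v q
fibLike-unique {u} {v} u-fib v-fib eq₀ eq₁ q = proj₁ (agree q)
  where
  agree : ∀ q → u q ≡ v q × u (1 + q) ≡ v (1 + q)
  agree zero = eq₀ , eq₁
  agree (suc q) with agree q
  ... | eq , eq′ = eq′ , (begin
    u (2 + q)         ≡⟨ step u-fib q ⟩
    u (1 + q) + u q   ≡⟨ cong₂ _+_ eq′ eq ⟩
    v (1 + q) + v q   ≡⟨ step v-fib q ⟨
    v (2 + q)         ∎)

fibLike-suc : ∀ {u} → IsFibLike u → IsFibLike (λ q → u (suc q))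
fibLike-suc u-fib = fibLike (λ q → step u-fib (suc q))

fibLike-+ : ∀ {u v} → IsFibLike u → IsFibLike v → IsFibLike (λ q → u q + v q)
fibLike-+ {u} {v} u-fib v-fib = fibLike λ q → begin
  u (2 + q) + v (2 + q)                  ≡⟨ cong₂ _+_ (step u-fib q) (step v-fib q) ⟩
  (u (1 + q) + u q) + (v (1 + q) + v q)  ≡⟨ interchange (u (1 + q)) (u q) (v (1 + q)) (v q) ⟩
  (u (1 + q) + v (1 + q)) + (u q + v q)  ∎
  where
  interchange : ∀ a b c d → (a + b) + (c + d) ≡ (a + c) + (b + d)
  interchange = solve-∀

Near : ℕ → ℕ → Set
Near f j = f ≡ j ⊎ f ≡ suc j ⊎ j ≡ suc f

module Interleaved (x : ℕ → ℕ) {k : ℕ} (x-rec : ∀ n → x (6 + n) ≡ x (4 + n) + x (2 + n) + k) where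

  every-other-fibLike : ∀ r → IsFibLike (λ q → x (q + q + (2 + r)) + k)
  every-other-fibLike r = fibLike λ q → let n = q + q + r in begin
    x (2 + q + (2 + q) + (2 + r)) + k        ≡⟨ cong (λ i → x i + k) (index 2 q r) ⟩
    x (6 + n) + k                            ≡⟨ cong (_+ k) (x-rec n) ⟩
    x (4 + n) + x (2 + n) + k + k            ≡⟨ regroup (x (4 + n)) (x (2 + n)) k ⟩
    (x (4 + n) + k) + (x (2 + n) + k)        ≡⟨ cong₂ (λ i i′ → (x i + k) + (x i′ + k)) (index 1 q r) (index 0 q r) ⟨
    (x (1 + q + (1 + q) + (2 + r)) + k) + (x (q + q + (2 + r)) + k) ∎
    where
    index : ∀ d q r → d + q + (d + q) + (2 + r) ≡ 2 * d + 2 + (q + q + r)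
    index = solve-∀
    regroup : ∀ a b k → a + b + k + k ≡ (a + k) + (b + k)
    regroup = solve-∀

  near-interleaved : ∀ {u} → IsFibLike u →
                     x 3 + k ≡ u 1 + u 1 → x 5 + k ≡ u 2 + u 2 →
                     x 4 + k ≡ u 1 + u 2 → x 6 + k ≡ u 2 + u 3 →
                     ∀ {f j} → Near f j → x (f + j + 3) + k ≡ u (suc f) + u (suc j)
  near-interleaved {u} u-fib x₃ x₅ x₄ x₆ (inj₁ refl) = odd-sub _
    where
    odd-sub : ∀ q → x (q + q + 3) + k ≡ u (suc q) + u (suc q)
    odd-sub = fibLike-unique (every-other-fibLike 1) (fibLike-+ (fibLike-suc u-fib) (fibLike-suc u-fib)) x₃ x₅
  near-interleaved {u} u-fib x₃ x₅ x₄ x₆ (inj₂ fj) = adjacent fj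
    where
    even-sub : ∀ q → x (q + q + 4) + k ≡ u (1 + q) + u (2 + q)
    even-sub = fibLike-unique (every-other-fibLike 2) (fibLike-+ (fibLike-suc u-fib) (fibLike-suc (fibLike-suc u-fib))) x₄ x₆
    adjacent : ∀ {f j} → f ≡ suc j ⊎ j ≡ suc f → x (f + j + 3) + k ≡ u (suc f) + u (suc j)
    adjacent {j = q} (inj₁ refl) = begin
      x (suc q + q + 3) + k   ≡⟨ cong (λ i → x i + k) (index q) ⟩
      x (q + q + 4) + k       ≡⟨ even-sub q ⟩
      u (1 + q) + u (2 + q)   ≡⟨ +-comm (u (1 + q)) (u (2 + q)) ⟩
      u (2 + q) + u (1 + q)   ∎
      where
      index : ∀ q → suc q + q + 3 ≡ q + q + 4
      index = solve-∀
    adjacent {f = q} (inj₂ refl) = trans (cong (λ i → x i + k) (index q)) (even-sub q)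
      where
      index : ∀ q → q + suc q + 3 ≡ q + q + 4
      index = solve-∀

open Interleaved using (near-interleaved)

balanced⇒near : ∀ {n f j} → Balanced n f j → Near f j
balanced⇒near {n} (odd , even) with n % 2 | m%n<n n 2
... | 0 | _ = inj₂ (even refl)
... | 1 | _ = inj₁ (odd refl)
... | suc (suc _) | s≤s (s≤s ())

module Weighted (w c : ℕ) where

  weight : Expr → ℕ
  weight one = 0
  weight (a _) = w
  weight (b _) = w
  weight (e ⊕ f) = c + (weight e + weight f)
  weight (e ⊗ f) = weight e + weight f

  record Profile (m : ℕ) : Set where
    constructor profile
    field
      short : Vec ℕ (suc (suc m))
      long  : Vec ℕ (suc m)

  weigh : ∀ {m} → State m → Profile m
  weigh (st s l) = profile (map weight s) (map weight l)

  forkʷ : ∀ {m} → Profile (suc m) → Profile m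
  forkʷ (profile (A ∷ B ∷ ss) (D ∷ C ∷ ls)) = profile ((c + (D + (A + B))) ∷ ss) ((A + C) ∷ ls)

  jointʷ : ∀ {m} → Profile (suc m) → Profile m
  jointʷ (profile s l) =
    profile (init (init s) ∷ʳ (c + (last l + (last (init s) + last s)))) (init (init l) ∷ʳ (last (init l) + last s))

  runʷ : ∀ {m} → Vec Step m → Profile m → ℕ
  runʷ [] (profile (A ∷ B ∷ []) (D ∷ [])) = c + (D + (A + B))
  runʷ (Fork ∷ ps) σ = runʷ ps (forkʷ σ)
  runʷ (Joint ∷ ps) σ = runʷ ps (jointʷ σ)

  weigh-fork : ∀ {m} (σ : State (suc m)) → weigh (fork σ) ≡ forkʷ (weigh σ)
  weigh-fork (st (A ∷ B ∷ ss) (D ∷ C ∷ ls)) = refl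

  weigh-joint : ∀ {m} (σ : State (suc m)) → weigh (joint σ) ≡ jointʷ (weigh σ)
  weigh-joint (st s l) = cong₂ profile
    (trans (map-∷ʳ weight _ (init (init s)))
           (cong₂ _∷ʳ_ (init² s) (cong (c +_) (cong₂ _+_ (map-last weight l) (cong₂ _+_ (penultimate s) (map-last weight s))))))
    (trans (map-∷ʳ weight _ (init (init l)))
           (cong₂ _∷ʳ_ (init² l) (cong₂ _+_ (penultimate l) (map-last weight s))))
    where
    init² : ∀ {n} (xs : Vec Expr (suc (suc n))) → map weight (init (init xs)) ≡ init (init (map weight xs))
    init² xs = trans (map-init weight (init xs)) (cong init (map-init weight xs))
    penultimate : ∀ {n} (xs : Vec Expr (suc (suc n))) → weight (last (init xs)) ≡ last (init (map weight xs))
    penultimate xs = trans (map-last weight (init xs)) (cong last (map-init weight xs))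

  weight-run : ∀ {m} (ps : Vec Step m) (σ : State m) → weight (run ps σ) ≡ runʷ ps (weigh σ)
  weight-run [] (st (A ∷ B ∷ []) (D ∷ [])) = refl
  weight-run (Fork ∷ ps) σ = trans (weight-run ps (fork σ)) (cong (runʷ ps) (weigh-fork σ))
  weight-run (Joint ∷ ps) σ = trans (weight-run ps (joint σ)) (cong (runʷ ps) (weigh-joint σ))

  -- Labels of the outermost short and long edge after f forks (by symmetry, also after f joints).
  S L : ℕ → ℕ
  S zero = w
  S (suc f) = c + (L f + (S f + w))
  L zero = w
  L (suc f) = S f + w

  U : ℕ → ℕ
  U f = S f + (2 * w + c)

  U-fibLike : IsFibLike U
  U-fibLike = fibLike λ q → shift w c (S q) (S (suc q))
    where
    shift : ∀ w c s s₁ → c + ((s + w) + (s₁ + w)) + (2 * w + c) ≡ (s₁ + (2 * w + c)) + (s + (2 * w + c))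
    shift = solve-∀

  bordered : ∀ K (X U V Y : ℕ) → Profile (suc K)
  bordered K X U V Y = profile (X ∷ (replicate (suc K) w ∷ʳ Y)) (U ∷ (replicate K w ∷ʳ V))

  jointʷ-∷ʳ : ∀ {m} (s : Vec ℕ (suc m)) B A (l : Vec ℕ m) C D →
              jointʷ (profile ((s ∷ʳ B) ∷ʳ A) ((l ∷ʳ C) ∷ʳ D)) ≡ profile (s ∷ʳ (c + (D + (B + A)))) (l ∷ʳ (C + A))
  jointʷ-∷ʳ s B A l C D
    rewrite init-∷ʳ A (s ∷ʳ B) | init-∷ʳ B s | last-∷ʳ A (s ∷ʳ B) | last-∷ʳ B s
          | init-∷ʳ D (l ∷ʳ C) | init-∷ʳ C l | last-∷ʳ D (l ∷ʳ C) | last-∷ʳ C l = refl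

  jointʷ-bordered : ∀ K X U V Y → jointʷ (bordered (suc K) X U V Y) ≡ bordered K X U (w + Y) (c + (V + (w + Y)))
  jointʷ-bordered K X U V Y = trans
    (cong₂ (λ s l → jointʷ (profile (X ∷ (s ∷ʳ Y)) (U ∷ (l ∷ʳ V)))) (replicate-∷ʳ (suc K) w) (replicate-∷ʳ K w))
    (jointʷ-∷ʳ (X ∷ replicate (suc K) w) w Y (U ∷ replicate K w) w V)

  run-bordered : ∀ K (ps : Vec Step (suc K)) f j →
                 runʷ ps (bordered K (S f) (L f) (L j) (S j)) + (7 * w + 3 * c)
                   ≡ U (suc (countForks ps + f)) + U (suc (countJoints ps + j))
  run-bordered zero (Fork ∷ []) f j = fork-last w c (S f) (S (suc f)) (L j) (S j)
    where
    fork-last : ∀ w c s s₁ l′ s′ → c + ((s + l′) + (s₁ + s′)) + (7 * w + 3 * c)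
                  ≡ (c + ((s + w) + (s₁ + w))) + (2 * w + c) + ((c + (l′ + (s′ + w))) + (2 * w + c))
    fork-last = solve-∀
  run-bordered zero (Joint ∷ []) f j = joint-last w c (L f) (S f) (L j) (S j)
    where
    joint-last : ∀ w c l s l′ s′ → c + ((l + s′) + (s + (c + (l′ + (w + s′))))) + (7 * w + 3 * c)
                   ≡ (c + (l + (s + w))) + (2 * w + c) + ((c + ((s′ + w) + ((c + (l′ + (s′ + w))) + w))) + (2 * w + c))
    joint-last = solve-∀
  run-bordered (suc K) (Fork ∷ ps) f j =
    trans (run-bordered K ps (suc f) j) (cong (λ i → U (suc i) + U (suc (countJoints ps + j))) (+-suc (countForks ps) f))
  run-bordered (suc K) (Joint ∷ ps) f j = begin
    runʷ ps (jointʷ (bordered (suc K) (S f) (L f) (L j) (S j))) + k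
      ≡⟨ cong (λ σ → runʷ ps σ + k) (jointʷ-bordered K (S f) (L f) (L j) (S j)) ⟩
    runʷ ps (bordered K (S f) (L f) (w + S j) (c + (L j + (w + S j)))) + k
      ≡⟨ cong (λ z → runʷ ps (bordered K (S f) (L f) z (c + (L j + z))) + k) (+-comm w (S j)) ⟩
    runʷ ps (bordered K (S f) (L f) (L (suc j)) (S (suc j))) + k
      ≡⟨ run-bordered K ps f (suc j) ⟩
    U (suc (countForks ps + f)) + U (suc (countJoints ps + suc j))
      ≡⟨ cong (λ i → U (suc (countForks ps + f)) + U (suc i)) (+-suc (countJoints ps) j) ⟩
    U (suc (countForks ps + f)) + U (suc (suc (countJoints ps + j))) ∎
    where
    k : ℕ
    k = 7 * w + 3 * c

  weigh-fibGraph : ∀ K → weigh (fibGraph (suc K)) ≡ bordered K w w w w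
  weigh-fibGraph K = cong₂ profile (uniform (suc K) (λ i → a (suc (toℕ i))) (λ _ → refl))
                                   (uniform K (λ i → b (suc (toℕ i))) (λ _ → refl))
    where
    uniform : ∀ n (label : Fin (suc (suc n)) → Expr) → (∀ i → weight (label i) ≡ w) →
              map weight (tabulate label) ≡ w ∷ (replicate n w ∷ʳ w)
    uniform n label label≡w = begin
      map weight (tabulate label)  ≡⟨ tabulate-∘ weight label ⟨
      tabulate (weight ∘ label)    ≡⟨ tabulate-cong label≡w ⟩
      tabulate (const w)           ≡⟨ tabulate-allFin (const w) ⟩
      map (const w) (allFin _)     ≡⟨ map-const (allFin _) w ⟩
      replicate (suc (suc n)) w    ≡⟨ cong (w ∷_) (replicate-∷ʳ n w) ⟩
      w ∷ (replicate n w ∷ʳ w)     ∎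

  weight-fibGraph : ∀ m (ps : Vec Step m) →
                    weight (run ps (fibGraph m)) + (7 * w + 3 * c) ≡ U (suc (countForks ps)) + U (suc (countJoints ps))
  weight-fibGraph zero [] = triangle w c
    where
    triangle : ∀ w c → c + (w + (w + w)) + (7 * w + 3 * c)
                 ≡ (c + (w + (w + w)) + (2 * w + c)) + (c + (w + (w + w)) + (2 * w + c))
    triangle = solve-∀
  weight-fibGraph (suc K) ps = begin
    weight (run ps (fibGraph (suc K))) + k          ≡⟨ cong (_+ k) (weight-run ps (fibGraph (suc K))) ⟩
    runʷ ps (weigh (fibGraph (suc K))) + k          ≡⟨ cong (λ σ → runʷ ps σ + k) (weigh-fibGraph K) ⟩
    runʷ ps (bordered K w w w w) + k                ≡⟨ run-bordered K ps 0 0 ⟩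
    U (suc (countForks ps + 0)) + U (suc (countJoints ps + 0))
      ≡⟨ cong₂ (λ f j → U (suc f) + U (suc j)) (+-identityʳ (countForks ps)) (+-identityʳ (countJoints ps)) ⟩
    U (suc (countForks ps)) + U (suc (countJoints ps)) ∎
    where
    k : ℕ
    k = 7 * w + 3 * c

open Weighted using (weight; U; U-fibLike; weight-fibGraph)

terms≡weight : ∀ e → terms e ≡ weight 1 0 e
terms≡weight one = refl
terms≡weight (a _) = refl
terms≡weight (b _) = refl
terms≡weight (e ⊕ f) = cong₂ _+_ (terms≡weight e) (terms≡weight f)
terms≡weight (e ⊗ f) = cong₂ _+_ (terms≡weight e) (terms≡weight f)

pluses≡weight : ∀ e → pluses e ≡ weight 0 1 e
pluses≡weight one = refl
pluses≡weight (a _) = refl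
pluses≡weight (b _) = refl
pluses≡weight (e ⊕ f) = cong suc (cong₂ _+_ (pluses≡weight e) (pluses≡weight f))
pluses≡weight (e ⊗ f) = cong₂ _+_ (pluses≡weight e) (pluses≡weight f)

countForks+countJoints : ∀ {m} (ps : Vec Step m) → countForks ps + countJoints ps ≡ m
countForks+countJoints [] = refl
countForks+countJoints (Fork ∷ ps) = cong suc (countForks+countJoints ps)
countForks+countJoints (Joint ∷ ps) = trans (+-suc (countForks ps) (countJoints ps)) (cong suc (countForks+countJoints ps))

weight-optimal : ∀ w c (x : ℕ → ℕ) → (∀ n → x (6 + n) ≡ x (4 + n) + x (2 + n) + (7 * w + 3 * c)) →
                 let k = 7 * w + 3 * c ; u = U w c in
                 x 3 + k ≡ u 1 + u 1 → x 5 + k ≡ u 2 + u 2 → x 4 + k ≡ u 1 + u 2 → x 6 + k ≡ u 2 + u 3 →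
                 ∀ m (ps : Vec Step m) → Balanced (m + 3) (countForks ps) (countJoints ps) →
                 weight w c (run ps (fibGraph m)) ≡ x (m + 3)
weight-optimal w c x x-rec x₃ x₅ x₄ x₆ m ps balanced = +-cancelʳ-≡ k _ _ (begin
  weight w c (run ps (fibGraph m)) + k  ≡⟨ weight-fibGraph w c m ps ⟩
  U w c (suc F) + U w c (suc J)         ≡⟨ near-interleaved x x-rec (U-fibLike w c) x₃ x₅ x₄ x₆ (balanced⇒near {m + 3} balanced) ⟨
  x (F + J + 3) + k                     ≡⟨ cong (λ i → x (i + 3) + k) (countForks+countJoints ps) ⟩
  x (m + 3) + k                         ∎)
  where
  k F J : ℕ
  k = 7 * w + 3 * c
  F = countForks ps
  J = countJoints ps

theorem5 : ∀ (n : ℕ) → 1 ≤ n → ∀ (e : Expr) → OptimalExpr n e →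
    terms e ≡ T n × pluses e ≡ P n
theorem5 .1 _ .one opt1 = refl , refl
theorem5 .2 _ .(a 1) opt2 = refl , refl
theorem5 .(m + 3) _ .(run ps (fibGraph m)) (optRun m ps balanced) =
  trans (terms≡weight e) (weight-optimal 1 0 T (λ _ → refl) refl refl refl refl m ps balanced) ,
  trans (pluses≡weight e) (weight-optimal 0 1 P (λ _ → refl) refl refl refl refl m ps balanced)
  where
  e : Expr
  e = run ps (fibGraph m)
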